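{- Let $F=(V,E)$ be a multigraph and let $\ell:V\to[n]$ be a labelling such that each pair $(i,j)$ appears an even number of times as the label $(\ell(u),\ell(v))$ of an edge $\{u,v\}\in E$. Then \[ |\{\ell(v):v\in V\}|\le \frac{|E|}{2}+(\text{number of connected components of }F). \]
   Context: Labels of edges are unordered pairs $\{\ell(u),\ell(v)\}$; "appears an even number of times" counts the edges of $F$ (with multiplicity) carrying that label pair. -}

module Defs where

open import Data.Nat using (ℕ)
open import Data.Nat.Divisibility using (_∣_)
open import Data.Fin using (Fin)
open import Data.Fin.Properties using (any?) renaming (_≟_ to _≟ᶠ_)
open import Data.List using (List; length; filter; allFin)
open import Data.List.Membership.Propositional using (_∈_)
open import Data.Product using (_×_; _,_; ∃; Σ)
open import Data.Sum using (_⊎_)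
open import Relation.Binary.PropositionalEquality using (_≡_)
open import Relation.Binary.Construct.Closure.ReflexiveTransitive using (Star)
open import Relation.Nullary using (Dec)
open import Relation.Nullary.Decidable using (_×-dec_; _⊎-dec_)
open import Function.Bundles using (_⇔_)

-- A (finite) multigraph on vertex set Fin m: edges are a list of vertex
-- pairs (each entry is one edge {u,v}; repetitions = parallel edges).
record Multigraph (m : ℕ) : Set where
  constructor mkMultigraph
  field
    edges : List (Fin m × Fin m)
open Multigraph public

numEdges : ∀ {m} → Multigraph m → ℕ
numEdges F = length (edges F)

Adj : ∀ {m} → Multigraph m → Fin m → Fin m → Set
Adj F u v = ((u , v) ∈ edges F) ⊎ ((v , u) ∈ edges F)

Connected : ∀ {m} → Multigraph m → Fin m → Fin m → Set
Connected F = Star (Adj F)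

-- F has exactly c connected components: there is a surjective map from the
-- vertices onto Fin c whose fibres are exactly the connected components.
HasComponents : ∀ {m} → Multigraph m → ℕ → Set
HasComponents {m} F c =
  Σ (Fin m → Fin c) λ comp →
    (∀ (k : Fin c) → ∃ λ v → comp v ≡ k) ×
    (∀ u v → (comp u ≡ comp v) ⇔ Connected F u v)

HasLabel : ∀ {m n} → (Fin m → Fin n) → Fin n → Fin n → Fin m × Fin m → Set
HasLabel ℓ i j (u , v) = ((ℓ u ≡ i) × (ℓ v ≡ j)) ⊎ ((ℓ u ≡ j) × (ℓ v ≡ i))

hasLabel? : ∀ {m n} (ℓ : Fin m → Fin n) i j (e : Fin m × Fin m) → Dec (HasLabel ℓ i j e)
hasLabel? ℓ i j (u , v) = ((ℓ u ≟ᶠ i) ×-dec (ℓ v ≟ᶠ j)) ⊎-dec ((ℓ u ≟ᶠ j) ×-dec (ℓ v ≟ᶠ i))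

labelCount : ∀ {m n} → Multigraph m → (Fin m → Fin n) → Fin n → Fin n → ℕ
labelCount F ℓ i j = length (filter (hasLabel? ℓ i j) (edges F))

EvenLabelling : ∀ {m n} → Multigraph m → (Fin m → Fin n) → Set
EvenLabelling F ℓ = ∀ i j → 2 ∣ labelCount F ℓ i j

numLabelsUsed : ∀ {m n} → (Fin m → Fin n) → ℕ
numLabelsUsed {m} {n} ℓ = length (filter (λ i → any? (λ v → ℓ v ≟ᶠ i)) (allFin n))

-- Take an edge e with labels {a,b}.  By evenness at least two edges carry
-- the pair {a,b}, and deleting all of them keeps the labelling even.  By
-- induction the smaller graph has a map g on labels, constant along its
-- edges, with 2·|im ℓ| ≤ |E'| + 2·|im (g ∘ ℓ)|.  Identifying g a with g b costs
-- at most one label, paid for by the two deleted edges, and makes the map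
-- constant along all edges of F, hence on components: it takes at most c values.
module Submission where

open import Defs
open import Data.Nat using (ℕ; zero; suc; _≤_; _<_; _+_; _*_; z≤n; s≤s; >-nonZero)
open import Data.Nat.Properties
open import Data.Nat.Divisibility using (_∣_; _∣0; ∣⇒≤)
open import Data.Nat.Induction using (<-wellFounded)
open import Algebra.Properties.CommutativeSemigroup +-commutativeSemigroup using (x∙yz≈y∙xz)
open import Data.Fin using (Fin) renaming (zero to fzero; suc to fsuc)
open import Data.Fin.Properties using (any?) renaming (_≟_ to _≟ᶠ_)
open import Data.List using (List; []; _∷_; length; filter; allFin)
open import Data.List.Properties using (filter-some; filter-none; filter-reject)
open import Data.List.Membership.Propositional using (_∈_)
open import Data.List.Membership.Propositional.Properties using (∈-filter⁺)
import Data.List.Relation.Unary.All as All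
open import Data.List.Relation.Unary.All.Properties using (all-filter)
import Data.List.Relation.Unary.Any as Any
open import Data.List.Relation.Unary.Unique.Propositional using (Unique)
open import Data.List.Relation.Unary.Unique.Propositional.Properties using (allFin⁺)
open import Data.List.Relation.Unary.AllPairs using ([]; _∷_)
open import Data.List.Relation.Binary.Sublist.Propositional using (⊆-refl)
open import Data.List.Relation.Binary.Sublist.Propositional.Properties using (filter⁺)
open import Data.List.Relation.Binary.Sublist.Heterogeneous.Properties using (length-mono-≤)
open import Data.Product using (Σ; ∃; _×_; _,_; proj₁; proj₂)
open import Data.Sum using (_⊎_; inj₁; inj₂; swap)
open import Function using (id; _∘_)
open import Function.Bundles using (Equivalence)
open import Induction.WellFounded using (Acc; acc)
open import Level using (0ℓ)
open import Relation.Binary.PropositionalEquality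
open import Relation.Binary.Definitions using (DecidableEquality)
open import Relation.Binary.Construct.Closure.ReflexiveTransitive using (fold)
open import Relation.Nullary using (yes; no; ¬_; ¬?; contradiction)
open import Relation.Unary using (Pred; Decidable)
open import Relation.Unary.Properties using (_∪?_)

module _ {A : Set} {P Q : Pred A 0ℓ} (P? : Decidable P) (Q? : Decidable Q) where

  length-filter-mono : (∀ {x} → P x → Q x) → ∀ xs →
    length (filter P? xs) ≤ length (filter Q? xs)
  length-filter-mono P⊆Q xs = length-mono-≤ (filter⁺ P? Q? (λ { refl → P⊆Q }) (⊆-refl {x = xs}))

  length-filter-∪ : ∀ xs →
    length (filter (P? ∪? Q?) xs) ≤ length (filter P? xs) + length (filter Q? xs)
  length-filter-∪ [] = ≤-refl
  length-filter-∪ (x ∷ xs) with ih ← length-filter-∪ xs | P? x | Q? x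
  ... | yes _ | yes _ = s≤s (≤-trans ih (+-monoʳ-≤ _ (n≤1+n _)))
  ... | yes _ | no _  = s≤s ih
  ... | no _  | yes _ = ≤-trans (s≤s ih) (≤-reflexive (sym (+-suc _ _)))
  ... | no _  | no _  = ih

  filter-filter-⊆ : (∀ {x} → P x → Q x) → ∀ xs → filter P? (filter Q? xs) ≡ filter P? xs
  filter-filter-⊆ P⊆Q [] = refl
  filter-filter-⊆ P⊆Q (x ∷ xs) with Q? x
  ... | no ¬q = trans (filter-filter-⊆ P⊆Q xs) (sym (filter-reject P? (¬q ∘ P⊆Q)))
  ... | yes _ with P? x
  ...   | yes _ = cong (x ∷_) (filter-filter-⊆ P⊆Q xs)
  ...   | no _  = filter-filter-⊆ P⊆Q xs

module _ {A : Set} {P : Pred A 0ℓ} (P? : Decidable P) where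

  length-filter-split : ∀ xs → length (filter P? xs) + length (filter (¬? ∘ P?) xs) ≡ length xs
  length-filter-split [] = refl
  length-filter-split (x ∷ xs) with P? x
  ... | yes _ = cong suc (length-filter-split xs)
  ... | no _  = trans (+-suc _ _) (cong suc (length-filter-split xs))

  length-filter-≤-1 : (∀ {x y} → P x → P y → x ≡ y) → ∀ {xs} → Unique xs →
    length (filter P? xs) ≤ 1
  length-filter-≤-1 P-unique [] = z≤n
  length-filter-≤-1 P-unique {x ∷ xs} (x∉xs ∷ xs-unique) with P? x
  ... | no _  = length-filter-≤-1 P-unique xs-unique
  ... | yes px = s≤s (≤-reflexive (cong length (filter-none P?
                   (All.map (λ x≢y py → x≢y (P-unique px py)) x∉xs))))

length-filter-≤-insert : ∀ {A : Set} {P Q : Pred A 0ℓ} (P? : Decidable P) (Q? : Decidable Q)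
  (_≟_ : DecidableEquality A) {y : A} → (∀ {x} → P x → Q x ⊎ x ≡ y) → ∀ {xs} → Unique xs →
  length (filter P? xs) ≤ suc (length (filter Q? xs))
length-filter-≤-insert P? Q? _≟_ {y} P⊆Q+y {xs} xs-unique = begin
  length (filter P? xs)                                   ≤⟨ length-filter-mono P? (Q? ∪? (_≟ y)) P⊆Q+y xs ⟩
  length (filter (Q? ∪? (_≟ y)) xs)                       ≤⟨ length-filter-∪ Q? (_≟ y) xs ⟩
  length (filter Q? xs) + length (filter (_≟ y) xs)       ≤⟨ +-monoʳ-≤ _ (length-filter-≤-1 (_≟ y) (λ x≡y z≡y → trans x≡y (sym z≡y)) xs-unique) ⟩
  length (filter Q? xs) + 1                               ≡⟨ +-comm _ 1 ⟩
  suc (length (filter Q? xs))                             ∎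
  where open ≤-Reasoning

module _ {n : ℕ} where

  numLabelsUsed-mono : ∀ {d e} (f : Fin d → Fin n) (g : Fin e → Fin n) →
    (∀ v → ∃ λ w → g w ≡ f v) → numLabelsUsed f ≤ numLabelsUsed g
  numLabelsUsed-mono f g covers = length-filter-mono
    (λ i → any? (λ v → f v ≟ᶠ i)) (λ i → any? (λ w → g w ≟ᶠ i))
    (λ { (v , refl) → covers v }) (allFin n)

  numLabelsUsed-≤-insert : ∀ {d e} (f : Fin d → Fin n) (g : Fin e → Fin n) (y : Fin n) →
    (∀ v → (∃ λ w → g w ≡ f v) ⊎ f v ≡ y) → numLabelsUsed f ≤ suc (numLabelsUsed g)
  numLabelsUsed-≤-insert f g y covers = length-filter-≤-insert
    (λ i → any? (λ v → f v ≟ᶠ i)) (λ i → any? (λ w → g w ≟ᶠ i)) _≟ᶠ_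
    (λ { (v , refl) → covers v }) (allFin⁺ n)

  numLabelsUsed-≤-domain : ∀ {d} (f : Fin d → Fin n) → numLabelsUsed f ≤ d
  numLabelsUsed-≤-domain {zero} f = ≤-reflexive (cong length
    (filter-none (λ i → any? (λ v → f v ≟ᶠ i)) (All.universal (λ _ → λ { (() , _) }) (allFin n))))
  numLabelsUsed-≤-domain {suc d} f = ≤-trans
    (numLabelsUsed-≤-insert f (f ∘ fsuc) (f fzero) (λ { fzero → inj₂ refl ; (fsuc w) → inj₁ (w , refl) }))
    (s≤s (numLabelsUsed-≤-domain (f ∘ fsuc)))

  merge : Fin n → Fin n → Fin n → Fin n
  merge α β x with x ≟ᶠ β
  ... | yes _ = α
  ... | no _  = x

  merge-identifies : ∀ α β → merge α β α ≡ merge α β β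
  merge-identifies α β with α ≟ᶠ β | β ≟ᶠ β
  ... | _     | no β≢β = contradiction refl β≢β
  ... | yes _ | yes _  = refl
  ... | no _  | yes _  = refl

  merge-fixes : ∀ α {β x} → ¬ x ≡ β → merge α β x ≡ x
  merge-fixes α {β} {x} x≢β with x ≟ᶠ β
  ... | yes x≡β = contradiction x≡β x≢β
  ... | no _    = refl

  numLabelsUsed-merge : ∀ {d} (f : Fin d → Fin n) α β →
    numLabelsUsed f ≤ suc (numLabelsUsed (merge α β ∘ f))
  numLabelsUsed-merge f α β = numLabelsUsed-≤-insert f (merge α β ∘ f) β covers
    where
    covers : ∀ v → (∃ λ w → merge α β (f w) ≡ f v) ⊎ f v ≡ β
    covers v with f v ≟ᶠ β
    ... | yes fv≡β = inj₂ fv≡β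
    ... | no fv≢β  = inj₁ (v , merge-fixes α fv≢β)

Respects : ∀ {m} {A : Set} → Multigraph m → (Fin m → A) → Set
Respects F f = ∀ {u v} → (u , v) ∈ edges F → f u ≡ f v

Respects⇒Connected⇒≡ : ∀ {m} {A : Set} {F : Multigraph m} {f : Fin m → A} →
  Respects F f → ∀ {u v} → Connected F u v → f u ≡ f v
Respects⇒Connected⇒≡ {f = f} resp = fold (λ u v → f u ≡ f v) (λ adj eq → trans (along adj) eq) refl
  where
  along : ∀ {u v} → Adj _ u v → f u ≡ f v
  along (inj₁ uv∈E) = resp uv∈E
  along (inj₂ vu∈E) = sym (resp vu∈E)

numLabelsUsed-≤-components : ∀ {m n c} {F : Multigraph m} {f : Fin m → Fin n} →
  HasComponents F c → Respects F f → numLabelsUsed f ≤ c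
numLabelsUsed-≤-components {m} {c = c} {f = f} (comp , onto , sameComp⇔connected) resp =
  ≤-trans (numLabelsUsed-mono f (f ∘ representative) covers) (numLabelsUsed-≤-domain (f ∘ representative))
  where
  representative : Fin c → Fin m
  representative k = proj₁ (onto k)
  covers : ∀ v → ∃ λ k → f (representative k) ≡ f v
  covers v = comp v , sym (Respects⇒Connected⇒≡ resp
    (Equivalence.to (sameComp⇔connected v _) (sym (proj₂ (onto (comp v))))))

module _ {m n : ℕ} (ℓ : Fin m → Fin n) where

  HasLabel-transfer : ∀ {i j a b} {e e′ : Fin m × Fin m} →
    HasLabel ℓ i j e → HasLabel ℓ a b e → HasLabel ℓ a b e′ → HasLabel ℓ i j e′
  HasLabel-transfer {e = _ , _} {_ , _} (inj₁ (refl , refl)) (inj₁ (refl , refl)) h = h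
  HasLabel-transfer {e = _ , _} {_ , _} (inj₁ (refl , refl)) (inj₂ (refl , refl)) h = swap h
  HasLabel-transfer {e = _ , _} {_ , _} (inj₂ (refl , refl)) (inj₁ (refl , refl)) h = swap h
  HasLabel-transfer {e = _ , _} {_ , _} (inj₂ (refl , refl)) (inj₂ (refl , refl)) h = h

  HasLabel⇒≡ : ∀ {A : Set} (h : Fin n → A) {a b u v} →
    h a ≡ h b → HasLabel ℓ a b (u , v) → h (ℓ u) ≡ h (ℓ v)
  HasLabel⇒≡ h ha≡hb (inj₁ (refl , refl)) = ha≡hb
  HasLabel⇒≡ h ha≡hb (inj₂ (refl , refl)) = sym ha≡hb

  HasLabel-own : ∀ {u v} → HasLabel ℓ (ℓ u) (ℓ v) (u , v)
  HasLabel-own = inj₁ (refl , refl)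

  removeLabelOf : Fin m × Fin m → Multigraph m → Multigraph m
  removeLabelOf (u , v) F = mkMultigraph (filter (¬? ∘ hasLabel? ℓ (ℓ u) (ℓ v)) (edges F))

  removeLabelOf-even : ∀ {F} e → EvenLabelling F ℓ → EvenLabelling (removeLabelOf e F) ℓ
  -- Either {i,j} is the label pair of e, and no such edge is left, or no
  -- edge with label {i,j} was removed.
  removeLabelOf-even {F} (u , v) even i j with hasLabel? ℓ i j (u , v)
  ... | yes ij-uv = subst (2 ∣_) (sym (cong length (filter-none (hasLabel? ℓ i j)
          (All.map (λ ¬ab ij → ¬ab (HasLabel-transfer HasLabel-own ij-uv ij)) (all-filter _ (edges F))))))
          (2 ∣0)
  ... | no ¬ij-uv = subst (2 ∣_) (sym (cong length (filter-filter-⊆ (hasLabel? ℓ i j) _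
          (λ ij ab → ¬ij-uv (HasLabel-transfer ij ab HasLabel-own)) (edges F))))
          (even i j)

  removeLabelOf-shrinks : ∀ {F} e → EvenLabelling F ℓ → e ∈ edges F →
    2 + numEdges (removeLabelOf e F) ≤ numEdges F
  removeLabelOf-shrinks {F} (u , v) even uv∈E = begin
    2 + length rest                 ≤⟨ +-monoˡ-≤ (length rest) (∣⇒≤ {{>-nonZero uv-label-occurs}} (even (ℓ u) (ℓ v))) ⟩
    labelCount F ℓ (ℓ u) (ℓ v) + length rest ≡⟨ length-filter-split (hasLabel? ℓ (ℓ u) (ℓ v)) (edges F) ⟩
    numEdges F                      ∎
    where
    open ≤-Reasoning
    rest : List (Fin m × Fin m)
    rest = edges (removeLabelOf (u , v) F)
    uv-label-occurs : 0 < labelCount F ℓ (ℓ u) (ℓ v)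
    uv-label-occurs = filter-some (hasLabel? ℓ (ℓ u) (ℓ v)) (Any.map (λ { refl → HasLabel-own }) uv∈E)

  merge-respects : ∀ {F} {u v} (g : Fin n → Fin n) →
    Respects (removeLabelOf (u , v) F) (g ∘ ℓ) →
    Respects F (merge (g (ℓ u)) (g (ℓ v)) ∘ g ∘ ℓ)
  merge-respects {u = u} {v} g resp {x} {y} xy∈E with hasLabel? ℓ (ℓ u) (ℓ v) (x , y)
  ... | yes uv-label = HasLabel⇒≡ (merge (g (ℓ u)) (g (ℓ v)) ∘ g) (merge-identifies (g (ℓ u)) (g (ℓ v))) uv-label
  ... | no ¬uv-label = cong (merge (g (ℓ u)) (g (ℓ v))) (resp (∈-filter⁺ _ xy∈E ¬uv-label))

  collapse : ∀ F → Acc _<_ (numEdges F) → EvenLabelling F ℓ →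
    Σ (Fin n → Fin n) λ g → Respects F (g ∘ ℓ) ×
      2 * numLabelsUsed ℓ ≤ numEdges F + 2 * numLabelsUsed (g ∘ ℓ)
  collapse (mkMultigraph []) _ _ = id , (λ ()) , ≤-refl
  collapse F@(mkMultigraph (e@(u , v) ∷ _)) (acc rec) even =
    let g , g-respects , g-bound = collapse F′ (rec (≤-trans (n≤1+n _) shrinks)) (removeLabelOf-even {F} e even)
    in merge (g (ℓ u)) (g (ℓ v)) ∘ g , merge-respects {F} g g-respects , merge-bound g g-bound
    where
    F′ : Multigraph m
    F′ = removeLabelOf e F
    shrinks : 2 + numEdges F′ ≤ numEdges F
    shrinks = removeLabelOf-shrinks {F} e even (Any.here refl)
    merge-bound : ∀ g → 2 * numLabelsUsed ℓ ≤ numEdges F′ + 2 * numLabelsUsed (g ∘ ℓ) →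
      2 * numLabelsUsed ℓ ≤ numEdges F + 2 * numLabelsUsed (merge (g (ℓ u)) (g (ℓ v)) ∘ g ∘ ℓ)
    merge-bound g g-bound = begin
      2 * numLabelsUsed ℓ                     ≤⟨ g-bound ⟩
      numEdges F′ + 2 * numLabelsUsed (g ∘ ℓ) ≤⟨ +-monoʳ-≤ _ (*-monoʳ-≤ 2 (numLabelsUsed-merge (g ∘ ℓ) _ _)) ⟩
      numEdges F′ + 2 * suc M                 ≡⟨ cong (numEdges F′ +_) (*-suc 2 M) ⟩
      numEdges F′ + (2 + 2 * M)               ≡⟨ x∙yz≈y∙xz (numEdges F′) 2 (2 * M) ⟩
      2 + numEdges F′ + 2 * M                 ≤⟨ +-monoˡ-≤ _ shrinks ⟩
      numEdges F + 2 * M                      ∎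
      where
      open ≤-Reasoning
      M : ℕ
      M = numLabelsUsed (merge (g (ℓ u)) (g (ℓ v)) ∘ g ∘ ℓ)

proposition4p2 : ∀ {m n : ℕ} (F : Multigraph m) (ℓ : Fin m → Fin n) (c : ℕ) →
    HasComponents F c → EvenLabelling F ℓ →
    2 * numLabelsUsed ℓ ≤ numEdges F + 2 * c
proposition4p2 F ℓ c components even =
  let g , g-respects , g-bound = collapse ℓ F (<-wellFounded (numEdges F)) even
  in ≤-trans g-bound
       (+-monoʳ-≤ (numEdges F) (*-monoʳ-≤ 2 (numLabelsUsed-≤-components components g-respects)))
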